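{- Let $\mathbf P=(P,\leq)$ be a non-empty poset and $a\in P$, and let $f_a\colon P\to P$ be the constant mapping with value $a$. Then $\mathbf P$ is up-directed and $a$ is a maximal element of $\mathbf P$ if and only if $f_a$ is upper cone preserving.
   Context: For $A\subseteq P$, $U(A)=\{x\in P\mid y\leq x\text{ for all }y\in A\}$; $U(x,y)=U(\{x,y\})$. $\mathbf P$ is up-directed if $U(x,y)\neq\emptyset$ for all $x,y\in P$. A mapping $f\colon P\to P$ is upper cone preserving if $f(U(x,y))=U(f(x),f(y))$ for all $x,y\in P$. -}

module Defs where

open import Level using (Level; _⊔_)
open import Data.Product using (Σ; _×_; ∃)
open import Relation.Binary.Bundles using (Poset)

module _ {c ℓ₁ ℓ₂ : Level} (𝐏 : Poset c ℓ₁ ℓ₂) where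
  open Poset 𝐏 renaming (Carrier to P)

  U₂ : P → P → P → Set ℓ₂
  U₂ x y z = (x ≤ z) × (y ≤ z)

  Image : (P → P) → (P → Set ℓ₂) → P → Set (c ⊔ ℓ₁ ⊔ ℓ₂)
  Image f S z = Σ P (λ w → S w × (f w ≈ z))

  UpDirected : Set (c ⊔ ℓ₂)
  UpDirected = ∀ x y → Σ P (λ z → U₂ x y z)

  Maximal : P → Set (c ⊔ ℓ₁ ⊔ ℓ₂)
  Maximal a = ∀ x → a ≤ x → x ≈ a

  UpperConePreserving : (P → P) → Set (c ⊔ ℓ₁ ⊔ ℓ₂)
  UpperConePreserving f = ∀ x y z →
    (Image f (U₂ x y) z → U₂ (f x) (f y) z) × (U₂ (f x) (f y) z → Image f (U₂ x y) z)

  const : P → P → P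
  const a _ = a

{-# OPTIONS --safe #-}
module Submission where

open import Defs
open import Level using (Level)
open import Data.Product using (_×_; _,_; proj₂)
open import Relation.Binary.Bundles using (Poset)
open import Function.Bundles using (_⇔_; mk⇔)

module ConstantMap {c ℓ₁ ℓ₂ : Level} (𝐏 : Poset c ℓ₁ ℓ₂) (a : Poset.Carrier 𝐏) where
  open Poset 𝐏 renaming (Carrier to P)

  -- The image of U(x,y) under const a is {a} when U(x,y) ≠ ∅ and empty otherwise,
  -- while U(a,a) is the upper cone of a: they agree iff U(x,y) ≠ ∅ and a is maximal.
  image-⊆-upperCone : ∀ x y z → Image 𝐏 (const 𝐏 a) (U₂ 𝐏 x y) z → U₂ 𝐏 a a z
  image-⊆-upperCone x y z (_ , _ , a≈z) = reflexive a≈z , reflexive a≈z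

  upperCone-⊆-image : UpDirected 𝐏 → Maximal 𝐏 a →
                      ∀ x y z → U₂ 𝐏 a a z → Image 𝐏 (const 𝐏 a) (U₂ 𝐏 x y) z
  upperCone-⊆-image upDirected maximal x y z (a≤z , _) =
    let (w , w∈Uxy) = upDirected x y in w , w∈Uxy , Eq.sym (maximal z a≤z)

  upperConePreserving⇒upDirected : UpperConePreserving 𝐏 (const 𝐏 a) → UpDirected 𝐏
  upperConePreserving⇒upDirected preserving x y =
    let (w , w∈Uxy , _) = proj₂ (preserving x y a) (refl , refl) in w , w∈Uxy

  upperConePreserving⇒maximal : UpperConePreserving 𝐏 (const 𝐏 a) → Maximal 𝐏 a
  upperConePreserving⇒maximal preserving z a≤z =
    let (_ , _ , a≈z) = proj₂ (preserving a a z) (a≤z , a≤z) in Eq.sym a≈z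

lemma2p2 : {c ℓ₁ ℓ₂ : Level} (𝐏 : Poset c ℓ₁ ℓ₂) (a : Poset.Carrier 𝐏) →
    (UpDirected 𝐏 × Maximal 𝐏 a) ⇔ UpperConePreserving 𝐏 (const 𝐏 a)
lemma2p2 𝐏 a = mk⇔
  (λ (upDirected , maximal) x y z →
     image-⊆-upperCone x y z , upperCone-⊆-image upDirected maximal x y z)
  (λ preserving →
     upperConePreserving⇒upDirected preserving , upperConePreserving⇒maximal preserving)
  where open ConstantMap 𝐏 a
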